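{- Let $\mathcal{M}$ be the Bose--Mesner algebra of a commutative $d$-class association scheme $\Xi=(X,\mathcal{R})$, and let $A\in\mathcal{M}$ be a $01$-matrix such that the (directed) graph $\Gamma=\Gamma(A)$ is strongly connected (connected, if $A$ is symmetric). Then: (i) for every vertex $x\in X$ there exists an $x$-distance-faithful equitable partition $\Pi_x$ of $\Gamma$ with exactly $d+1$ cells; (ii) the structure of the intersection diagram of $\Pi_x$ from (i) does not depend on $x$, i.e., the partitions $\Pi_x=\{\mathcal{P}_0(x),\dots,\mathcal{P}_d(x)\}$ can be chosen so that $|\mathcal{P}_i(x)|$ and the corresponding parameters $d^{\to}_{ij},d^{\leftarrow}_{ij}$ ($0\le i,j\le d$) are independent of $x$.
   Context: A commutative $d$-class association scheme $\Xi=(X,\{R_0,\dots,R_d\})$ on a finite set $X$ consists of nonempty relations whose $01$ adjacency matrices $A_i$ satisfy: $A_0=I$; $\sum_i A_i=J$; $A_i^\top\in\{A_0,\dots,A_d\}$; each $A_iA_j$ is a linear combination of $A_0,\dots,A_d$; $A_iA_j=A_jA_i$. Its Bose--Mesner algebra is $\mathcal{M}=\mathrm{span}\{A_0,\dots,A_d\}$. For a $01$-matrix $A$, $\Gamma(A)$ is the directed graph on $X$ with arc $x\to y$ iff $A_{xy}=1$. Let $\Gamma_1^{\to}(y)=\{z:(y,z)\text{ an arc}\}$, $\Gamma_1^{\leftarrow}(y)=\{z:(z,y)\text{ an arc}\}$, $\partial(x,y)$ the length of a shortest directed walk from $x$ to $y$, and $\Gamma_i(x)=\{z:\partial(x,z)=i\}$.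 A partition $\{\mathcal{P}_0,\dots,\mathcal{P}_s\}$ of $X$ is equitable if for all $i,j$ there are numbers $d^{\to}_{ij},d^{\leftarrow}_{ij}$ with $|\Gamma_1^{\to}(y)\cap\mathcal{P}_j|=d^{\to}_{ij}$ and $|\Gamma_1^{\leftarrow}(y)\cap\mathcal{P}_j|=d^{\leftarrow}_{ij}$ for every $y\in\mathcal{P}_i$ (the corresponding parameters). It is $x$-distance-faithful if $\mathcal{P}_0=\{x\}$ and it refines the distance partition $\{\Gamma_i(x)\}_i$, i.e., each cell is contained in some $\Gamma_i(x)$. Its intersection diagram records the cells and the corresponding parameters. -}

module Defs where

open import Data.Nat using (ℕ; zero; suc; _+_; _<_)
open import Data.Fin using (Fin; zero; suc; _≟_)
open import Data.Bool using (Bool; true; false; if_then_else_; _∧_)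
open import Data.Product using (Σ; _×_; _,_; ∃; ∃-syntax)
open import Relation.Binary.PropositionalEquality using (_≡_)
open import Relation.Nullary using (¬_)
open import Relation.Nullary.Decidable using (⌊_⌋)

count : ∀ {n} → (Fin n → Bool) → ℕ
count {zero}  f = 0
count {suc n} f = (if f zero then 1 else 0) + count (λ i → f (suc i))

-- The vertex set X is Fin n.  The relations R_0,…,R_d partition X×X;
-- rel x y is the index i with (x,y) ∈ R_i.  The 01 adjacency matrix A_i is adj i.
module _ {n d : ℕ} (rel : Fin n → Fin n → Fin (suc d)) where
  adj : Fin (suc d) → Fin n → Fin n → Bool
  adj i x y = ⌊ rel x y ≟ i ⌋

  prodEntry : Fin (suc d) → Fin (suc d) → Fin n → Fin n → ℕ
  prodEntry i j x y = count (λ z → adj i x z ∧ adj j z y)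

record AssociationScheme (n d : ℕ) : Set where
  field
    rel : Fin n → Fin n → Fin (suc d)
    nonempty : ∀ i → ∃[ x ] ∃[ y ] rel x y ≡ i
    diag₁ : ∀ x y → rel x y ≡ zero → x ≡ y
    diag₂ : ∀ x → rel x x ≡ zero
    -- A_i^T ∈ {A_0,…,A_d}
    transpose : ∀ i → ∃[ i' ] (∀ x y → (rel y x ≡ i → rel x y ≡ i') × (rel x y ≡ i' → rel y x ≡ i))
    -- A_i A_j is a linear combination of A_0,…,A_d
    closed : ∀ i j → Σ (Fin (suc d) → ℕ) λ p → (∀ x y → prodEntry {n} {d} rel i j x y ≡ p (rel x y))
    commutative : ∀ i j x y → prodEntry {n} {d} rel i j x y ≡ prodEntry {n} {d} rel j i x y

data Walk {n : ℕ} (A : Fin n → Fin n → Bool) : Fin n → Fin n → ℕ → Set where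
  here : ∀ {x} → Walk A x x 0
  step : ∀ {x y z k} → A x y ≡ true → Walk A y z k → Walk A x z (suc k)

StronglyConnected : ∀ {n} → (Fin n → Fin n → Bool) → Set
StronglyConnected A = ∀ x y → ∃[ k ] Walk A x y k

Dist : ∀ {n} → (Fin n → Fin n → Bool) → Fin n → Fin n → ℕ → Set
Dist A x y k = Walk A x y k × (∀ m → m < k → ¬ Walk A x y m)

-- A partition of X into cells P_0,…,P_d, given by cell assignment P : X → Fin (suc d).
-- It has exactly d+1 cells (all cells nonempty).
AllCellsNonempty : ∀ {n d} → (Fin n → Fin (suc d)) → Set
AllCellsNonempty {n} {d} P = ∀ (i : Fin (suc d)) → ∃[ z ] P z ≡ i

cellSize : ∀ {n d} → (Fin n → Fin (suc d)) → Fin (suc d) → ℕ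
cellSize P i = count (λ z → ⌊ P z ≟ i ⌋)

EquitableWith : ∀ {n d} → (Fin n → Fin n → Bool) → (Fin n → Fin (suc d)) →
                (Fin (suc d) → Fin (suc d) → ℕ) → (Fin (suc d) → Fin (suc d) → ℕ) → Set
EquitableWith A P dout din =
  ∀ y j → (count (λ z → A y z ∧ ⌊ P z ≟ j ⌋) ≡ dout (P y) j)
        × (count (λ z → A z y ∧ ⌊ P z ≟ j ⌋) ≡ din (P y) j)

DistanceFaithful : ∀ {n d} → (Fin n → Fin n → Bool) → Fin n → (Fin n → Fin (suc d)) → Set
DistanceFaithful A x P =
  (P x ≡ zero) × (∀ z → P z ≡ zero → z ≡ x)
  × (∀ z w k → P z ≡ P w → Dist A x z k → Dist A x w k)

-- Take Π_x to be the partition of X by the relation R(x,·).  Every quantity the statement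
-- asks about (a cell size, the number of out- or in-neighbours of y in a cell, the existence
-- of a walk of given length from x to y) is governed by the numbers of z with a prescribed
-- pair (R(x,z), R(z,y)).  These are sums of intersection numbers p^h_ab with h = R(x,y), so
-- they depend only on the cell of y, and neither on x nor on y itself.
{-# OPTIONS --safe #-}
module Submission where

open import Defs
open import Data.Nat using (ℕ; zero; suc; _+_; _<_; s≤s; z≤n)
open import Data.Nat.Properties using (+-0-commutativeMonoid)
open import Data.Fin using (Fin; zero; suc; _≟_)
open import Data.Bool using (Bool; true; false; _∧_; if_then_else_)
open import Data.Bool.Properties using (∧-assoc; ∧-comm; ∧-zeroʳ)
open import Data.Product using (_×_; ∃-syntax; Σ-syntax; _,_; proj₁; proj₂)
open import Function using (_∘_)
open import Function.Bundles using (_⇔_; mk⇔)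
open import Relation.Nullary using (Dec; yes; no)
open import Relation.Nullary.Decidable using (⌊_⌋; isYes; isYes≗does; ⌊⌋-map′; does-⇔)
open import Relation.Binary.PropositionalEquality
  using (_≡_; refl; sym; trans; cong; cong₂; subst; ≡-≟-identity; module ≡-Reasoning)
open import Algebra.Properties.CommutativeMonoid.Sum +-0-commutativeMonoid
  using (sum-syntax; sum-cong-≗; sum-replicate-zero; ∑-comm)

iverson : Bool → ℕ
iverson b = if b then 1 else 0

count≡∑ : ∀ {n} (f : Fin n → Bool) → count f ≡ ∑[ z < n ] iverson (f z)
count≡∑ {zero}  f = refl
count≡∑ {suc n} f = cong (iverson (f zero) +_) (count≡∑ (f ∘ suc))

count-cong : ∀ {n} {f g : Fin n → Bool} → (∀ z → f z ≡ g z) → count f ≡ count g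
count-cong {f = f} {g} f≗g =
  trans (count≡∑ f) (trans (sum-cong-≗ (cong iverson ∘ f≗g)) (sym (count≡∑ g)))

count-const-∧ : ∀ {n} b (h : Fin n → Bool) → count (λ z → b ∧ h z) ≡ (if b then count h else 0)
count-const-∧     true  h = refl
count-const-∧ {n} false h = trans (count≡∑ {n} (λ _ → false)) (sum-replicate-zero n)

witness⇒0<count : ∀ {n} (f : Fin n → Bool) z → f z ≡ true → 0 < count f
witness⇒0<count f zero    fz≡true rewrite fz≡true = s≤s z≤n
witness⇒0<count f (suc z) fz≡true with f zero
... | true  = s≤s z≤n
... | false = witness⇒0<count (f ∘ suc) z fz≡true

0<count⇒witness : ∀ {n} (f : Fin n → Bool) → 0 < count f → ∃[ z ] f z ≡ true
0<count⇒witness {suc n} f pos with f zero in f0≡true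
... | true  = zero , f0≡true
... | false with 0<count⇒witness (f ∘ suc) pos
...   | z , fz≡true = suc z , fz≡true

∑-delta : ∀ {m} (k : Fin m) → ∑[ a < m ] iverson ⌊ k ≟ a ⌋ ≡ 1
∑-delta {suc m} zero    = cong suc (sum-replicate-zero m)
∑-delta {suc m} (suc k) =
  trans (sum-cong-≗ (λ a → cong iverson (⌊⌋-map′ _ _ (k ≟ a)))) (∑-delta k)

iverson-fibres : ∀ {m} b (k : Fin m) → iverson b ≡ ∑[ a < m ] iverson (b ∧ ⌊ k ≟ a ⌋)
iverson-fibres     true  k = sym (∑-delta k)
iverson-fibres {m} false k = sym (sum-replicate-zero m)

count-fibres : ∀ {n m} (g : Fin n → Fin m) (f : Fin n → Bool) →
               count f ≡ ∑[ a < m ] count (λ z → f z ∧ ⌊ g z ≟ a ⌋)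
count-fibres {n} {m} g f = begin
  count f                                                ≡⟨ count≡∑ f ⟩
  ∑[ z < n ] iverson (f z)                               ≡⟨ sum-cong-≗ (λ z → iverson-fibres (f z) (g z)) ⟩
  ∑[ z < n ] ∑[ a < m ] iverson (f z ∧ ⌊ g z ≟ a ⌋)     ≡⟨ ∑-comm (λ z a → iverson (f z ∧ ⌊ g z ≟ a ⌋)) ⟩
  ∑[ a < m ] ∑[ z < n ] iverson (f z ∧ ⌊ g z ≟ a ⌋)     ≡⟨ sum-cong-≗ (λ a → sym (count≡∑ (λ z → f z ∧ ⌊ g z ≟ a ⌋))) ⟩
  ∑[ a < m ] count (λ z → f z ∧ ⌊ g z ≟ a ⌋)            ∎
  where open ≡-Reasoning

∧-⌊≟⌋-subst : ∀ {m} (P : Fin m → Bool) u a → P u ∧ ⌊ u ≟ a ⌋ ≡ P a ∧ ⌊ u ≟ a ⌋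
∧-⌊≟⌋-subst P u a with u ≟ a
... | yes refl = refl
... | no  _    = trans (∧-zeroʳ (P u)) (sym (∧-zeroʳ (P a)))

⌊⌋-⇔ : {P Q : Set} → P ⇔ Q → (p? : Dec P) (q? : Dec Q) → ⌊ p? ⌋ ≡ ⌊ q? ⌋
⌊⌋-⇔ P⇔Q p? q? = trans (isYes≗does p?) (trans (does-⇔ P⇔Q p? q?) (sym (isYes≗does q?)))

⌊≟⌋≡true⇒≡ : ∀ {m} {i j : Fin m} → ⌊ i ≟ j ⌋ ≡ true → i ≡ j
⌊≟⌋≡true⇒≡ {i = i} {j} eq with i ≟ j
... | yes i≡j = i≡j

⌊≟⌋-refl : ∀ {m} (i : Fin m) → ⌊ i ≟ i ⌋ ≡ true
⌊≟⌋-refl i = cong isYes (≡-≟-identity _≟_ refl)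

∧≡true⇒ : ∀ {a b} → a ∧ b ≡ true → a ≡ true × b ≡ true
∧≡true⇒ {true} {true} _ = refl , refl

module Scheme {n d : ℕ} (S : AssociationScheme n d) where
  open AssociationScheme S

  InBoseMesner : {B : Set} → (Fin n → Fin n → B) → Set
  InBoseMesner f = ∀ {x y x′ y′} → rel x y ≡ rel x′ y′ → f x y ≡ f x′ y′

  classValue : {B : Set} → (Fin n → Fin n → B) → Fin (suc d) → B
  classValue f i = f (proj₁ (nonempty i)) (proj₁ (proj₂ (nonempty i)))

  classValue-rel : {B : Set} {f : Fin n → Fin n → B} →
                   InBoseMesner f → ∀ x y → f x y ≡ classValue f (rel x y)
  classValue-rel f∈𝓜 x y = f∈𝓜 (sym (proj₂ (proj₂ (nonempty (rel x y)))))

  transpose-∈ : {B : Set} {f : Fin n → Fin n → B} →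
                InBoseMesner f → InBoseMesner (λ x y → f y x)
  transpose-∈ f∈𝓜 {x} {y} {x′} {y′} xy≡x′y′ with transpose (rel x y)
  ... | _ , transposeᵀ =
    f∈𝓜 (trans (proj₁ (transposeᵀ y x) refl) (sym (proj₁ (transposeᵀ y′ x′) (sym xy≡x′y′))))

  prodEntry-∈ : ∀ a b → InBoseMesner (prodEntry rel a b)
  prodEntry-∈ a b {x} {y} {x′} {y′} xy≡x′y′ with closed a b
  ... | p , product≡p = trans (product≡p x y) (trans (cong p xy≡x′y′) (sym (product≡p x′ y′)))

  triangle-transfer : ∀ {x z x′ z′} → rel x z ≡ rel x′ z′ →
                      ∀ y → ∃[ y′ ] rel x′ y′ ≡ rel x y × rel y′ z′ ≡ rel y z
  triangle-transfer {x} {z} {x′} {z′} xz≡x′z′ y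
    with 0<count⇒witness _ (subst (0 <_) (prodEntry-∈ (rel x y) (rel y z) xz≡x′z′) through-y)
    where
    through-y : 0 < prodEntry rel (rel x y) (rel y z) x z
    through-y = witness⇒0<count _ y
      (cong₂ _∧_ (⌊≟⌋-refl (rel x y)) (⌊≟⌋-refl (rel y z)))
  ... | y′ , through-y′ with ∧≡true⇒ through-y′
  ... | x′y′ , y′z′ = y′ , ⌊≟⌋≡true⇒≡ x′y′ , ⌊≟⌋≡true⇒≡ y′z′

  pathCount : (Fin (suc d) → Fin (suc d) → Bool) → Fin n → Fin n → ℕ
  pathCount F x y = count (λ z → F (rel x z) (rel z y))

  pathCount-expand : ∀ F x y → pathCount F x y ≡
    ∑[ a < suc d ] ∑[ b < suc d ] (if F a b then prodEntry rel a b x y else 0)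
  pathCount-expand F x y = begin
    count (λ z → F (rel x z) (rel z y))
      ≡⟨ count-fibres (rel x) (λ z → F (rel x z) (rel z y)) ⟩
    ∑[ a < suc d ] count (λ z → F (rel x z) (rel z y) ∧ ⌊ rel x z ≟ a ⌋)
      ≡⟨ sum-cong-≗ (λ a → count-cong (λ z → ∧-⌊≟⌋-subst (λ u → F u (rel z y)) (rel x z) a)) ⟩
    ∑[ a < suc d ] count (λ z → F a (rel z y) ∧ ⌊ rel x z ≟ a ⌋)
      ≡⟨ sum-cong-≗ (λ a → count-fibres (λ z → rel z y) (λ z → F a (rel z y) ∧ ⌊ rel x z ≟ a ⌋)) ⟩
    ∑[ a < suc d ] ∑[ b < suc d ] count (λ z → (F a (rel z y) ∧ ⌊ rel x z ≟ a ⌋) ∧ ⌊ rel z y ≟ b ⌋)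
      ≡⟨ sum-cong-≗ (λ a → sum-cong-≗ (λ b → count-cong (λ z →
           ∧-⌊≟⌋-subst (λ v → F a v ∧ ⌊ rel x z ≟ a ⌋) (rel z y) b))) ⟩
    ∑[ a < suc d ] ∑[ b < suc d ] count (λ z → (F a b ∧ ⌊ rel x z ≟ a ⌋) ∧ ⌊ rel z y ≟ b ⌋)
      ≡⟨ sum-cong-≗ (λ a → sum-cong-≗ (λ b → count-cong (λ z → ∧-assoc (F a b) ⌊ rel x z ≟ a ⌋ ⌊ rel z y ≟ b ⌋))) ⟩
    ∑[ a < suc d ] ∑[ b < suc d ] count (λ z → F a b ∧ (⌊ rel x z ≟ a ⌋ ∧ ⌊ rel z y ≟ b ⌋))
      ≡⟨ sum-cong-≗ (λ a → sum-cong-≗ (λ b → count-const-∧ (F a b) (λ z → ⌊ rel x z ≟ a ⌋ ∧ ⌊ rel z y ≟ b ⌋))) ⟩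
    ∑[ a < suc d ] ∑[ b < suc d ] (if F a b then prodEntry rel a b x y else 0)
      ∎
    where open ≡-Reasoning

  pathCount-∈ : ∀ F → InBoseMesner (pathCount F)
  pathCount-∈ F {x} {y} {x′} {y′} xy≡x′y′ =
    trans (pathCount-expand F x y)
      (trans (sum-cong-≗ (λ a → sum-cong-≗ (λ b →
                cong (if F a b then_else 0) (prodEntry-∈ a b xy≡x′y′))))
             (sym (pathCount-expand F x′ y′)))

  relCellSize : Fin (suc d) → ℕ
  relCellSize i = classValue (pathCount (λ a _ → ⌊ a ≟ i ⌋)) zero

  cellSize-rel : ∀ x i → cellSize (rel x) i ≡ relCellSize i
  cellSize-rel x i =
    trans (classValue-rel (pathCount-∈ (λ a _ → ⌊ a ≟ i ⌋)) x x)
          (cong (classValue (pathCount (λ a _ → ⌊ a ≟ i ⌋))) (diag₂ x))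

  rel-allCellsNonempty : ∀ x → AllCellsNonempty (rel x)
  rel-allCellsNonempty x i with nonempty i
  ... | u , v , uv≡i with triangle-transfer (trans (diag₂ u) (sym (diag₂ x))) v
  ...   | z , xz≡uv , _ = z , trans xz≡uv uv≡i

module Digraph {n d : ℕ} (S : AssociationScheme n d) (A : Fin n → Fin n → Bool)
               (c : Fin (suc d) → Bool) (A≡c : ∀ x y → A x y ≡ c (AssociationScheme.rel S x y))
               where
  open AssociationScheme S
  open Scheme S

  A-∈ : InBoseMesner A
  A-∈ {x} {y} {x′} {y′} xy≡x′y′ = trans (A≡c x y) (trans (cong c xy≡x′y′) (sym (A≡c x′ y′)))

  walk-transfer : ∀ {k x z x′ z′} → rel x z ≡ rel x′ z′ → Walk A x z k → Walk A x′ z′ k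
  walk-transfer {x′ = x′} {z′} xx≡x′z′ here =
    subst (λ t → Walk A x′ t 0) (diag₁ x′ z′ (trans (sym xx≡x′z′) (diag₂ _))) here
  walk-transfer xz≡x′z′ (step {y = y} Axy walk) with triangle-transfer xz≡x′z′ y
  ... | y′ , x′y′≡xy , y′z′≡yz = step (trans (A-∈ x′y′≡xy) Axy) (walk-transfer (sym y′z′≡yz) walk)

  dist-transfer : ∀ {k x z w} → rel x z ≡ rel x w → Dist A x z k → Dist A x w k
  dist-transfer {k} xz≡xw (walk , shortest) =
    walk-transfer xz≡xw walk , λ m m<k walkₘ → shortest m m<k (walk-transfer (sym xz≡xw) walkₘ)

  rel-distanceFaithful : ∀ x → DistanceFaithful A x (rel x)
  rel-distanceFaithful x = diag₂ x , (λ z xz≡0 → sym (diag₁ x z xz≡0)) , λ _ _ _ → dist-transfer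

  outCount inCount : Fin (suc d) → Fin n → Fin n → ℕ
  outCount j x y = count (λ z → A y z ∧ ⌊ rel x z ≟ j ⌋)
  inCount  j x y = count (λ z → A z y ∧ ⌊ rel x z ≟ j ⌋)

  outCount-∈ : ∀ j → InBoseMesner (outCount j)
  outCount-∈ j xy≡x′y′ = trans (outCount≡pathCount _ _) (trans
    (transpose-∈ (pathCount-∈ (λ a b → c a ∧ ⌊ b ≟ jᵀ ⌋)) xy≡x′y′) (sym (outCount≡pathCount _ _)))
    where
    jᵀ : Fin (suc d)
    jᵀ = proj₁ (transpose j)
    outCount≡pathCount : ∀ x y → outCount j x y ≡ pathCount (λ a b → c a ∧ ⌊ b ≟ jᵀ ⌋) y x
    outCount≡pathCount x y = count-cong (λ z → cong₂ _∧_ (A≡c y z)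
      (⌊⌋-⇔ (mk⇔ (proj₁ (proj₂ (transpose j) z x)) (proj₂ (proj₂ (transpose j) z x)))
              (rel x z ≟ j) (rel z x ≟ jᵀ)))

  inCount-∈ : ∀ j → InBoseMesner (inCount j)
  inCount-∈ j xy≡x′y′ = trans (inCount≡pathCount _ _) (trans
    (pathCount-∈ (λ a b → ⌊ a ≟ j ⌋ ∧ c b) xy≡x′y′) (sym (inCount≡pathCount _ _)))
    where
    inCount≡pathCount : ∀ x y → inCount j x y ≡ pathCount (λ a b → ⌊ a ≟ j ⌋ ∧ c b) x y
    inCount≡pathCount x y = count-cong (λ z →
      trans (∧-comm (A z y) ⌊ rel x z ≟ j ⌋) (cong (⌊ rel x z ≟ j ⌋ ∧_) (A≡c z y)))

  rel-equitable : ∀ x → EquitableWith A (rel x) (λ i j → classValue (outCount j) i)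
                                                (λ i j → classValue (inCount j) i)
  rel-equitable x y j = classValue-rel (outCount-∈ j) x y , classValue-rel (inCount-∈ j) x y

theorem1p2 : ∀ {n d : ℕ} (S : AssociationScheme n d) (A : Fin n → Fin n → Bool)
    → (Σ[ c ∈ (Fin (suc d) → Bool) ] (∀ x y → A x y ≡ c (AssociationScheme.rel S x y)))
    → StronglyConnected A
    → Σ[ size ∈ (Fin (suc d) → ℕ) ] Σ[ dout ∈ (Fin (suc d) → Fin (suc d) → ℕ) ]
    Σ[ din ∈ (Fin (suc d) → Fin (suc d) → ℕ) ] (∀ (x : Fin n) → Σ[ P ∈ (Fin n → Fin (suc d)) ]
    ( AllCellsNonempty P
    × DistanceFaithful A x P
    × EquitableWith A P dout din
    × (∀ i → cellSize P i ≡ size i)))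
theorem1p2 S A (c , A≡c) _ =
  relCellSize , (λ i j → classValue (outCount j) i) , (λ i j → classValue (inCount j) i) ,
  λ x → rel x , rel-allCellsNonempty x , rel-distanceFaithful x , rel-equitable x , cellSize-rel x
  where
  open AssociationScheme S
  open Scheme S
  open Digraph S A c A≡c
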